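{- Let $k\ge 2$ and $n\ge 1$. For a traversal string $t=t_1\cdots t_n$ of length $n$ let $L(t)=b(t,1)-a(t,1)+1$, where $a(t,1)=\prod_{j=1}^n t_j$ and $b(t,1)=k^n+1-\prod_{j=1}^n(k+1-t_j)$ (so $L(t)$ is the number of chips that can end on $v_t$). Call $t$ nontrivial if it is neither the string of $n$ ones nor the string of $n$ copies of $k$. Then the shortest length $L(t)$ over nontrivial $t$ is $k^{n-1}$, and it is achieved when $t$ consists of $n-1$ ones and one $2$, or when $t$ consists of $n-1$ copies of $k$ and one $k-1$. The longest possible length $L(t)$ is \[k^n+2-k^{\lfloor n/2\rfloor}-k^{\lceil n/2\rceil},\] and it is achieved when $t$ consists of $\lfloor n/2\rfloor$ ones and $\lceil n/2\rceil$ copies of $k$, or vice versa.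
   Context: The infinite rooted directed $k$-ary tree: every vertex has $k$ children ordered left to right; the root is on layer 1. A traversal string $t=t_1\cdots t_i$ with $t_\ell\in\{1,\dots,k\}$ determines the vertex $v_t$ reached from the root by moving at step $\ell$ to the $t_\ell$-th leftmost child. In labeled chip-firing starting with chips $1,\dots,k^n$ at the root (a vertex with at least $k$ chips may fire by choosing any $k$ of its chips and sending the $r$-th smallest to the $r$-th leftmost child), every stable configuration has one chip on each vertex of layer $n+1$, and the set of chips that can end on $v_t$ (for $t$ of length $n$) is exactly the integer interval $[a(t,1),b(t,1)]$ defined in the claim. -}

module Defs where

open import Data.Nat using (ℕ; zero; suc; _+_; _*_; _∸_; _^_; _≟_)
open import Data.Fin using (Fin; toℕ)
open import Data.Vec using (Vec; []; _∷_; map)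
open import Data.Integer using (ℤ; +_; _-_) renaming (_+_ to _+ℤ_)
open import Relation.Nullary using (does)
open import Data.Bool using (true; false)
open import Relation.Binary.PropositionalEquality using (_≡_)

-- A traversal string of length n over the k-ary tree: t_j ∈ {1,…,k},
-- represented as Vec (Fin k) n where entry i : Fin k encodes t_j = toℕ i + 1.
TString : ℕ → ℕ → Set
TString k n = Vec (Fin k) n

letter : {k : ℕ} → Fin k → ℕ
letter i = suc (toℕ i)

prodℕ : {n : ℕ} → Vec ℕ n → ℕ
prodℕ [] = 1
prodℕ (x ∷ xs) = x * prodℕ xs

aₜ : {k n : ℕ} → TString k n → ℕ
aₜ t = prodℕ (map letter t)

bₜ : {k n : ℕ} → TString k n → ℤ
bₜ {k} {n} t = (+ (k ^ n) +ℤ + 1) - + prodℕ (map (λ i → (k + 1) ∸ letter i) t)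

Lₜ : {k n : ℕ} → TString k n → ℤ
Lₜ t = (bₜ t - + aₜ t) +ℤ + 1

countLetter : {k n : ℕ} → ℕ → TString k n → ℕ
countLetter v [] = 0
countLetter v (x ∷ xs) with does (letter x ≟ v)
... | true  = suc (countLetter v xs)
... | false = countLetter v xs

AllOnes : {k n : ℕ} → TString k n → Set
AllOnes {k} {n} t = countLetter 1 t ≡ n

AllKs : {k n : ℕ} → TString k n → Set
AllKs {k} {n} t = countLetter k t ≡ n

-- With P = ∏ t_j and Q = ∏ (k+1-t_j) one has L(t) = k^n + 2 - (P + Q), so both
-- extremal problems are about S = P + Q. Prepending a letter p with complement q = k+1-p
-- sends (P, Q) to (pP, qQ).
-- Shortest: if P, Q ≥ 2 then pP + qQ + 2k ≤ k(P + Q) + 2, so S + k^(n-1) ≤ k^n + 2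
-- propagates along nontrivial strings; a nontrivial string whose tail is all ones or all
-- k's is estimated directly.
-- Longest: if cP ≤ dQ then c(pP) + d(qQ) ≥ (ck)P + dQ, and symmetrically, so each letter
-- can be replaced by 1 or k without increasing cP + dQ. Hence S ≥ k^i + k^j with i + j = n,
-- and by convexity of k^_ this is smallest for the balanced split.

module Submission where

open import Defs
open import Data.Nat using (ℕ; _≥_; _∸_; _^_; ⌊_/2⌋; ⌈_/2⌉)
open import Data.Integer using (+_; _-_) renaming (_+_ to _+ℤ_; _≤_ to _≤ℤ_)
open import Data.Product using (_×_)
open import Data.Sum using (_⊎_)
open import Relation.Binary.PropositionalEquality using (_≡_)
open import Relation.Nullary using (¬_)

open import Data.Bool using (true; false)
open import Data.Empty using (⊥-elim)
open import Data.Fin using (Fin)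
open import Data.Fin.Properties using (toℕ<n)
open import Data.Integer using (_⊖_; +≤+)
open import Data.Integer.Properties using (pos-+; [+m]-[+n]≡m⊖n; ⊖-≥; ⊖-monoʳ-≥-≤)
open import Data.Nat using (zero; suc; _+_; _*_; _≤_; _<_; z≤n; s≤s; s≤s⁻¹; _≡ᵇ_; _≟_; NonZero)
open import Data.Nat.Properties
open import Data.Product using (∃₂; _,_)
open import Data.Sum using (inj₁; inj₂; [_,_]′)
open import Function using (_∘_)
open import Relation.Binary.PropositionalEquality using (refl; sym; trans; cong; cong₂; subst; subst₂; _≢_)
open import Relation.Nullary using (yes; no; contradiction)
import Data.Integer.Tactic.RingSolver as ℤ
import Data.Nat.Tactic.RingSolver as ℕ

module Arithmetic where
  open import Data.List using ([]; _∷_)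
  open import Data.Nat.Tactic.RingSolver using (solve)
  open ≤-Reasoning

  rearrangement : ∀ {X Y E} → X ≤ Y → 1 ≤ E → X * E + Y ≤ X + E * Y
  rearrangement {X} {Y} X≤Y (s≤s {n = f} z≤n) = begin
    X * suc f + Y   ≡⟨ solve (X ∷ Y ∷ f ∷ []) ⟩
    X + (X * f + Y) ≤⟨ +-monoʳ-≤ X (+-monoˡ-≤ Y (*-monoˡ-≤ f X≤Y)) ⟩
    X + (Y * f + Y) ≡⟨ solve (X ∷ Y ∷ f ∷ []) ⟩
    X + suc f * Y   ∎

  weighted-sum-stepˡ : ∀ {k p q c d P Q} → 1 ≤ q → p + q ≡ suc k → c * P ≤ d * Q →
                       c * k * P + d * Q ≤ c * (p * P) + d * (q * Q)
  weighted-sum-stepˡ {k} {p} {c = c} {d} {P} {Q} (s≤s {n = r} z≤n) p+q≡1+k cP≤dQ = begin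
    c * k * P + d * Q                   ≡⟨ cong (λ k → c * k * P + d * Q) k≡p+r ⟩
    c * (p + r) * P + d * Q             ≡⟨ solve (c ∷ d ∷ p ∷ r ∷ P ∷ Q ∷ []) ⟩
    c * (p * P) + (d * Q + r * (c * P)) ≤⟨ +-monoʳ-≤ (c * (p * P)) (+-monoʳ-≤ (d * Q) (*-monoʳ-≤ r cP≤dQ)) ⟩
    c * (p * P) + (d * Q + r * (d * Q)) ≡⟨ solve (c ∷ d ∷ p ∷ r ∷ P ∷ Q ∷ []) ⟩
    c * (p * P) + d * (suc r * Q)       ∎
    where
    k≡p+r : k ≡ p + r
    k≡p+r = suc-injective (trans (sym p+q≡1+k) (+-suc p r))

  weighted-sum-stepʳ : ∀ {k p q c d P Q} → 1 ≤ p → p + q ≡ suc k → d * Q ≤ c * P →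
                       c * P + d * k * Q ≤ c * (p * P) + d * (q * Q)
  weighted-sum-stepʳ {p = p} {q} {c} {d} {P} {Q} 1≤p p+q≡1+k dQ≤cP =
    subst₂ _≤_ (+-comm (d * _ * Q) (c * P)) (+-comm (d * (q * Q)) (c * (p * P)))
      (weighted-sum-stepˡ {p = q} {p} {d} {c} {Q} {P} 1≤p (trans (+-comm q p) p+q≡1+k) dQ≤cP)

  sum-bound-base : ∀ {k p q} → p + q ≡ suc k → p * 1 + q * 1 + 1 ≡ k * 1 + 2
  sum-bound-base {k} {p} {q} p+q≡1+k = begin-equality
    p * 1 + q * 1 + 1 ≡⟨ solve (p ∷ q ∷ []) ⟩
    p + q + 1         ≡⟨ cong (_+ 1) p+q≡1+k ⟩
    suc k + 1         ≡⟨ solve (k ∷ []) ⟩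
    k * 1 + 2         ∎

  p*P+q*Q+2k≤k*[P+Q]+2 : ∀ {k p q P Q} → 1 ≤ p → 1 ≤ q → p + q ≡ suc k → 2 ≤ P → 2 ≤ Q →
                         p * P + q * Q + 2 * k ≤ k * (P + Q) + 2
  p*P+q*Q+2k≤k*[P+Q]+2 {P = P} {Q} (s≤s {n = s} z≤n) (s≤s {n = r} z≤n) refl 2≤P 2≤Q = begin
    suc s * P + suc r * Q + 2 * (s + suc r)
      ≡⟨ solve (s ∷ r ∷ P ∷ Q ∷ []) ⟩
    suc s * P + suc r * Q + 2 + (s * 2 + r * 2)
      ≤⟨ +-monoʳ-≤ (suc s * P + suc r * Q + 2) (+-mono-≤ (*-monoʳ-≤ s 2≤Q) (*-monoʳ-≤ r 2≤P)) ⟩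
    suc s * P + suc r * Q + 2 + (s * Q + r * P)
      ≡⟨ solve (s ∷ r ∷ P ∷ Q ∷ []) ⟩
    (s + suc r) * (P + Q) + 2 ∎

  sum-bound-step : ∀ {k p q P Q J} → 1 ≤ p → 1 ≤ q → p + q ≡ suc k → 2 ≤ P → 2 ≤ Q →
                   P + Q + J ≤ k * J + 2 → p * P + q * Q + k * J ≤ k * (k * J) + 2
  sum-bound-step {k} {p} {q} {P} {Q} {J} 1≤p 1≤q p+q≡1+k 2≤P 2≤Q P+Q+J≤kJ+2 =
    +-cancelʳ-≤ (2 * k) _ _ (begin
      p * P + q * Q + k * J + 2 * k   ≡⟨ solve (k ∷ p ∷ q ∷ P ∷ Q ∷ J ∷ []) ⟩
      p * P + q * Q + 2 * k + k * J   ≤⟨ +-monoˡ-≤ (k * J) (p*P+q*Q+2k≤k*[P+Q]+2 1≤p 1≤q p+q≡1+k 2≤P 2≤Q) ⟩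
      k * (P + Q) + 2 + k * J         ≡⟨ solve (k ∷ P ∷ Q ∷ J ∷ []) ⟩
      k * (P + Q + J) + 2             ≤⟨ +-monoˡ-≤ 2 (*-monoʳ-≤ k P+Q+J≤kJ+2) ⟩
      k * (k * J + 2) + 2             ≡⟨ solve (k ∷ J ∷ []) ⟩
      k * (k * J) + 2 + 2 * k         ∎)

  sum-bound-step-unitˡ : ∀ {k p q Q K} → p + q ≡ suc k → 2 ≤ p → 1 ≤ Q → Q ≤ K →
                         p * 1 + q * Q + K ≤ k * K + 2
  sum-bound-step-unitˡ {q = q} {Q} {K} refl (s≤s (s≤s {n = s} z≤n)) 1≤Q Q≤K = begin
    suc (suc s) * 1 + q * Q + K ≤⟨ +-monoˡ-≤ K (+-monoʳ-≤ (suc (suc s) * 1) (*-monoʳ-≤ q Q≤K)) ⟩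
    suc (suc s) * 1 + q * K + K ≡⟨ solve (s ∷ q ∷ K ∷ []) ⟩
    s * 1 + q * K + K + 2       ≤⟨ +-monoˡ-≤ 2 (+-monoˡ-≤ K (+-monoˡ-≤ (q * K) (*-monoʳ-≤ s 1≤K))) ⟩
    s * K + q * K + K + 2       ≡⟨ solve (s ∷ q ∷ K ∷ []) ⟩
    suc (s + q) * K + 2         ∎
    where
    1≤K : 1 ≤ K
    1≤K = ≤-trans 1≤Q Q≤K

  sum-bound-step-unitʳ : ∀ {k p q P K} → p + q ≡ suc k → 2 ≤ q → 1 ≤ P → P ≤ K →
                         p * P + q * 1 + K ≤ k * K + 2
  sum-bound-step-unitʳ {k} {p} {q} {P} {K} p+q≡1+k 2≤q 1≤P P≤K =
    subst (λ s → s + K ≤ k * K + 2) (+-comm (q * 1) (p * P))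
      (sum-bound-step-unitˡ (trans (+-comm q p) p+q≡1+k) 2≤q 1≤P P≤K)

  +m+2-[+a+b]≡[m+2]⊖[a+b] : ∀ m a b → (+ m +ℤ + 2) - (+ a +ℤ + b) ≡ (m + 2) ⊖ (a + b)
  +m+2-[+a+b]≡[m+2]⊖[a+b] m a b =
    trans (cong₂ _-_ (sym (pos-+ m 2)) (sym (pos-+ a b))) ([+m]-[+n]≡m⊖n (m + 2) (a + b))

  [+m+2-+a]-+b≡[m+2]⊖[a+b] : ∀ m a b → (+ m +ℤ + 2) - + a - + b ≡ (m + 2) ⊖ (a + b)
  [+m+2-+a]-+b≡[m+2]⊖[a+b] m a b = trans (regroup (+ m) (+ a) (+ b)) (+m+2-[+a+b]≡[m+2]⊖[a+b] m a b)
    where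
    regroup : ∀ M A B → (M +ℤ + 2) - A - B ≡ (M +ℤ + 2) - (A +ℤ B)
    regroup = ℤ.solve-∀

  m+n≤o⇒+n≤o⊖m : ∀ {m n o} → m + n ≤ o → + n ≤ℤ o ⊖ m
  m+n≤o⇒+n≤o⊖m {m} {n} {o} m+n≤o = subst (+ n ≤ℤ_) (sym (⊖-≥ (m+n≤o⇒m≤o m m+n≤o)))
    (+≤+ (m+n≤o⇒m≤o∸n n (subst (_≤ o) (+-comm m n) m+n≤o)))

  m+n≡o⇒o⊖m≡+n : ∀ {m n o} → m + n ≡ o → o ⊖ m ≡ + n
  m+n≡o⇒o⊖m≡+n {m} {n} refl = trans (⊖-≥ (m≤m+n m n)) (cong +_ (m+n∸m≡n m n))

open Arithmetic

-- Imported only now: its constructors would make the variable lists of `solve` above ambiguous.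
open import Data.Vec using (Vec; []; _∷_; map)

letterᶜ : {k : ℕ} → Fin k → ℕ
letterᶜ {k} i = (k + 1) ∸ letter i

aᶜₜ : {k n : ℕ} → TString k n → ℕ
aᶜₜ t = prodℕ (map letterᶜ t)

Lₜ≡⊖ : ∀ {k n} (t : TString k n) → Lₜ t ≡ (k ^ n + 2) ⊖ (aₜ t + aᶜₜ t)
Lₜ≡⊖ {k} {n} t =
  trans (regroup (+ (k ^ n)) (+ aₜ t) (+ aᶜₜ t)) (+m+2-[+a+b]≡[m+2]⊖[a+b] (k ^ n) (aₜ t) (aᶜₜ t))
  where
  regroup : ∀ K P Q → ((K +ℤ + 1) - Q - P) +ℤ + 1 ≡ (K +ℤ + 2) - (P +ℤ Q)
  regroup = ℤ.solve-∀

1≤letter : ∀ {k} (x : Fin k) → 1 ≤ letter x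
1≤letter x = s≤s z≤n

letter≤k : ∀ {k} (x : Fin k) → letter x ≤ k
letter≤k = toℕ<n

letter+letterᶜ : ∀ {k} (x : Fin k) → letter x + letterᶜ x ≡ suc k
letter+letterᶜ {k} x = trans (m+[n∸m]≡n (≤-trans (letter≤k x) (m≤m+n k 1))) (+-comm k 1)

1≤letterᶜ : ∀ {k} (x : Fin k) → 1 ≤ letterᶜ x
1≤letterᶜ {k} x = m<n⇒0<n∸m (≤-trans (s≤s (letter≤k x)) (≤-reflexive (+-comm 1 k)))

letterᶜ≤k : ∀ {k} (x : Fin k) → letterᶜ x ≤ k
letterᶜ≤k x = s≤s⁻¹ (≤-trans (+-monoˡ-≤ (letterᶜ x) (1≤letter x)) (≤-reflexive (letter+letterᶜ x)))

letterᶜ≡1⇒letter≡k : ∀ {k} (x : Fin k) → letterᶜ x ≡ 1 → letter x ≡ k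
letterᶜ≡1⇒letter≡k x e =
  suc-injective (trans (+-comm 1 (letter x)) (trans (cong (_+_ (letter x)) (sym e)) (letter+letterᶜ x)))

-- `countLetter` branches on `does (letter x ≟ v)`, which computes to `letter x ≡ᵇ v`.
countLetter-≡ : ∀ {k n v} {x : Fin k} (t : TString k n) → letter x ≡ v →
                countLetter v (x ∷ t) ≡ suc (countLetter v t)
countLetter-≡ {v = v} {x} t x≡v with letter x ≡ᵇ v | ≡⇒≡ᵇ (letter x) v x≡v
... | true  | _  = refl
... | false | ()

countLetter-≢ : ∀ {k n v} {x : Fin k} (t : TString k n) → letter x ≢ v →
                countLetter v (x ∷ t) ≡ countLetter v t
countLetter-≢ {v = v} {x} t x≢v with letter x ≡ᵇ v | ≡ᵇ⇒≡ (letter x) v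
... | true  | x≡v = contradiction (x≡v _) x≢v
... | false | _   = refl

countLetter+countLetter≤length : ∀ {k n u v} → u ≢ v → (t : TString k n) →
                                 countLetter u t + countLetter v t ≤ n
countLetter+countLetter≤length u≢v [] = z≤n
countLetter+countLetter≤length {u = u} {v} u≢v (x ∷ t) with letter x ≟ u | letter x ≟ v
... | yes x≡u | _ rewrite countLetter-≡ t x≡u | countLetter-≢ t (u≢v ∘ trans (sym x≡u)) =
  s≤s (countLetter+countLetter≤length u≢v t)
... | no x≢u | yes x≡v
  rewrite countLetter-≢ t x≢u | countLetter-≡ t x≡v | +-suc (countLetter u t) (countLetter v t) =
  s≤s (countLetter+countLetter≤length u≢v t)
... | no x≢u | no x≢v rewrite countLetter-≢ t x≢u | countLetter-≢ t x≢v =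
  m≤n⇒m≤1+n (countLetter+countLetter≤length u≢v t)

1≤prodℕ-map : ∀ {A : Set} {n} (f : A → ℕ) → (∀ x → 1 ≤ f x) → (xs : Vec A n) →
              1 ≤ prodℕ (map f xs)
1≤prodℕ-map f 1≤f [] = ≤-refl
1≤prodℕ-map f 1≤f (x ∷ xs) = *-mono-≤ (1≤f x) (1≤prodℕ-map f 1≤f xs)

prodℕ-map≤^ : ∀ {A : Set} {k n} (f : A → ℕ) → (∀ x → f x ≤ k) → (xs : Vec A n) →
              prodℕ (map f xs) ≤ k ^ n
prodℕ-map≤^ f f≤k [] = ≤-refl
prodℕ-map≤^ f f≤k (x ∷ xs) = *-mono-≤ (f≤k x) (prodℕ-map≤^ f f≤k xs)

prodℕ-map≡1⇒countLetter : ∀ {k n v} (f : Fin k → ℕ) → (∀ x → f x ≡ 1 → letter x ≡ v) →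
                           (t : TString k n) → prodℕ (map f t) ≡ 1 → countLetter v t ≡ n
prodℕ-map≡1⇒countLetter f f≡1⇒v [] _ = refl
prodℕ-map≡1⇒countLetter f f≡1⇒v (x ∷ t) prod≡1 =
  trans (countLetter-≡ t (f≡1⇒v x (m*n≡1⇒m≡1 (f x) (prodℕ (map f t)) prod≡1)))
        (cong suc (prodℕ-map≡1⇒countLetter f f≡1⇒v t (m*n≡1⇒n≡1 (f x) (prodℕ (map f t)) prod≡1)))

prodℕ-two-letters : ∀ {k n u v i j} (g : ℕ → ℕ) → u ≢ v → (t : TString k n) →
                    countLetter u t ≡ i → countLetter v t ≡ j → i + j ≡ n →
                    prodℕ (map (λ x → g (letter x)) t) ≡ g u ^ i * g v ^ j
prodℕ-two-letters g u≢v [] refl refl _ = refl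
prodℕ-two-letters {u = u} {v} g u≢v (x ∷ t) refl refl i+j≡n with letter x ≟ u | letter x ≟ v
... | yes x≡u | _ rewrite countLetter-≡ t x≡u | countLetter-≢ t (u≢v ∘ trans (sym x≡u)) | x≡u =
  trans (cong (g u *_) (prodℕ-two-letters g u≢v t refl refl (suc-injective i+j≡n)))
        (sym (*-assoc (g u) (g u ^ countLetter u t) (g v ^ countLetter v t)))
... | no x≢u | yes x≡v rewrite countLetter-≢ t x≢u | countLetter-≡ t x≡v | x≡v =
  trans (cong (g v *_) (prodℕ-two-letters g u≢v t refl refl
                          (suc-injective (trans (sym (+-suc (countLetter u t) (countLetter v t))) i+j≡n))))
        (*-left-comm (g v) (g u ^ countLetter u t) (g v ^ countLetter v t))
  where
  *-left-comm : ∀ a b c → a * (b * c) ≡ b * (a * c)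
  *-left-comm = ℕ.solve-∀
... | no x≢u | no x≢v rewrite countLetter-≢ t x≢u | countLetter-≢ t x≢v =
  ⊥-elim (1+n≰n (≤-trans (≤-reflexive (sym i+j≡n)) (countLetter+countLetter≤length u≢v t)))

1≤aₜ : ∀ {k n} (t : TString k n) → 1 ≤ aₜ t
1≤aₜ = 1≤prodℕ-map letter 1≤letter

1≤aᶜₜ : ∀ {k n} (t : TString k n) → 1 ≤ aᶜₜ t
1≤aᶜₜ = 1≤prodℕ-map letterᶜ 1≤letterᶜ

aₜ≤k^n : ∀ {k n} (t : TString k n) → aₜ t ≤ k ^ n
aₜ≤k^n = prodℕ-map≤^ letter letter≤k

aᶜₜ≤k^n : ∀ {k n} (t : TString k n) → aᶜₜ t ≤ k ^ n
aᶜₜ≤k^n = prodℕ-map≤^ letterᶜ letterᶜ≤k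

¬AllOnes⇒2≤aₜ : ∀ {k n} (t : TString k n) → ¬ AllOnes t → 2 ≤ aₜ t
¬AllOnes⇒2≤aₜ t ¬ones with m≤n⇒m<n∨m≡n (1≤aₜ t)
... | inj₁ 1<aₜ = 1<aₜ
... | inj₂ 1≡aₜ = contradiction (prodℕ-map≡1⇒countLetter letter (λ _ e → e) t (sym 1≡aₜ)) ¬ones

¬AllKs⇒2≤aᶜₜ : ∀ {k n} (t : TString k n) → ¬ AllKs t → 2 ≤ aᶜₜ t
¬AllKs⇒2≤aᶜₜ t ¬ks with m≤n⇒m<n∨m≡n (1≤aᶜₜ t)
... | inj₁ 1<aᶜₜ = 1<aᶜₜ
... | inj₂ 1≡aᶜₜ = contradiction (prodℕ-map≡1⇒countLetter letterᶜ letterᶜ≡1⇒letter≡k t (sym 1≡aᶜₜ)) ¬ks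

aₜ+aᶜₜ+k^m≤k^[1+m]+2 : ∀ {k} m (t : TString k (suc m)) → 2 ≤ aₜ t → 2 ≤ aᶜₜ t →
                       aₜ t + aᶜₜ t + k ^ m ≤ k ^ suc m + 2
aₜ+aᶜₜ+k^m≤k^[1+m]+2 zero (x ∷ []) _ _ = ≤-reflexive (sum-bound-base {p = letter x} (letter+letterᶜ x))
aₜ+aᶜₜ+k^m≤k^[1+m]+2 (suc m) (x ∷ t) 2≤P 2≤Q with m≤n⇒m<n∨m≡n (1≤aₜ t) | m≤n⇒m<n∨m≡n (1≤aᶜₜ t)
... | inj₂ 1≡aₜ | _ rewrite sym 1≡aₜ =
  sum-bound-step-unitˡ (letter+letterᶜ x) (subst (2 ≤_) (*-identityʳ (letter x)) 2≤P) (1≤aᶜₜ t) (aᶜₜ≤k^n t)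
... | _ | inj₂ 1≡aᶜₜ rewrite sym 1≡aᶜₜ =
  sum-bound-step-unitʳ (letter+letterᶜ x) (subst (2 ≤_) (*-identityʳ (letterᶜ x)) 2≤Q) (1≤aₜ t) (aₜ≤k^n t)
... | inj₁ 2≤aₜ | inj₁ 2≤aᶜₜ =
  sum-bound-step (1≤letter x) (1≤letterᶜ x) (letter+letterᶜ x) 2≤aₜ 2≤aᶜₜ
                 (aₜ+aᶜₜ+k^m≤k^[1+m]+2 m t 2≤aₜ 2≤aᶜₜ)

aₜ+aᶜₜ-two-letters : ∀ {k n u v i j} → u ≢ v → (t : TString k n) →
                     countLetter u t ≡ i → countLetter v t ≡ j → i + j ≡ n →
                     aₜ t + aᶜₜ t ≡ u ^ i * v ^ j + (k + 1 ∸ u) ^ i * (k + 1 ∸ v) ^ j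
aₜ+aᶜₜ-two-letters {k} u≢v t cu cv i+j≡n =
  cong₂ _+_ (prodℕ-two-letters (λ z → z) u≢v t cu cv i+j≡n)
            (prodℕ-two-letters (λ z → k + 1 ∸ z) u≢v t cu cv i+j≡n)

aₜ+aᶜₜ-ones-and-a-two : ∀ {k m} (t : TString (suc k) (suc m)) →
                        countLetter 1 t ≡ m → countLetter 2 t ≡ 1 →
                        aₜ t + aᶜₜ t + suc k ^ m ≡ suc k ^ suc m + 2
aₜ+aᶜₜ-ones-and-a-two {k} {m} t c₁ c₂
  rewrite aₜ+aᶜₜ-two-letters (λ ()) t c₁ c₂ (+-comm m 1) | ^-zeroˡ m | +-comm k 1 = balance k (suc k ^ m)
  where
  balance : ∀ k X → 1 * (2 * 1) + X * (k * 1) + X ≡ suc k * X + 2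
  balance = ℕ.solve-∀

aₜ+aᶜₜ-ks-and-a-predecessor : ∀ {k m} (t : TString (suc k) (suc m)) →
                              countLetter (suc k) t ≡ m → countLetter k t ≡ 1 →
                              aₜ t + aᶜₜ t + suc k ^ m ≡ suc k ^ suc m + 2
aₜ+aᶜₜ-ks-and-a-predecessor {k} {m} t cₖ cₖ₋₁
  rewrite aₜ+aᶜₜ-two-letters 1+n≢n t cₖ cₖ₋₁ (+-comm m 1) | m+n∸m≡n k 1 | ^-zeroˡ m
        | trans (cong (_∸ k) (sym (+-suc k 1))) (m+n∸m≡n k 2) = balance k (suc k ^ m)
  where
  balance : ∀ k X → X * (k * 1) + 1 * (2 * 1) + X ≡ suc k * X + 2
  balance = ℕ.solve-∀

aₜ+aᶜₜ-ones-and-ks : ∀ {k n i j} → 1 < k → (t : TString k n) →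
                     countLetter 1 t ≡ i → countLetter k t ≡ j → i + j ≡ n →
                     aₜ t + aᶜₜ t ≡ k ^ i + k ^ j
aₜ+aᶜₜ-ones-and-ks {k} {i = i} {j} 1<k t c₁ cₖ i+j≡n
  rewrite aₜ+aᶜₜ-two-letters (<⇒≢ 1<k) t c₁ cₖ i+j≡n | m+n∸n≡m k 1 | m+n∸m≡n k 1 | ^-zeroˡ i | ^-zeroˡ j =
  trans (cong₂ _+_ (*-identityˡ (k ^ j)) (*-identityʳ (k ^ i))) (+-comm (k ^ j) (k ^ i))

-- Each letter is replaced by 1 or by k, whichever does not increase c·aₜ + d·aᶜₜ; the factor k
-- it then contributes is moved into the weights.
weighted-sum-≥-extremal : ∀ {k n} c d (t : TString k n) →
                          ∃₂ λ i j → i + j ≡ n × c * k ^ i + d * k ^ j ≤ c * aₜ t + d * aᶜₜ t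
weighted-sum-≥-extremal c d [] = 0 , 0 , refl , ≤-refl
weighted-sum-≥-extremal {k} c d (x ∷ t) with ≤-total (c * aₜ t) (d * aᶜₜ t)
... | inj₁ cP≤dQ =
  let i , j , i+j≡n , ih = weighted-sum-≥-extremal (c * k) d t in
  suc i , j , cong suc i+j≡n , (begin
    c * k ^ suc i + d * k ^ j       ≡⟨ cong (λ s → s + d * k ^ j) (sym (*-assoc c k (k ^ i))) ⟩
    c * k * k ^ i + d * k ^ j       ≤⟨ ih ⟩
    c * k * aₜ t + d * aᶜₜ t
      ≤⟨ weighted-sum-stepˡ {c = c} {d = d} {P = aₜ t} {Q = aᶜₜ t} (1≤letterᶜ x) (letter+letterᶜ x) cP≤dQ ⟩
    c * aₜ (x ∷ t) + d * aᶜₜ (x ∷ t) ∎)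
  where open ≤-Reasoning
... | inj₂ dQ≤cP =
  let i , j , i+j≡n , ih = weighted-sum-≥-extremal c (d * k) t in
  i , suc j , trans (+-suc i j) (cong suc i+j≡n) , (begin
    c * k ^ i + d * k ^ suc j       ≡⟨ cong (_+_ (c * k ^ i)) (sym (*-assoc d k (k ^ j))) ⟩
    c * k ^ i + d * k * k ^ j       ≤⟨ ih ⟩
    c * aₜ t + d * k * aᶜₜ t
      ≤⟨ weighted-sum-stepʳ {c = c} {d = d} {P = aₜ t} {Q = aᶜₜ t} (1≤letter x) (letter+letterᶜ x) dQ≤cP ⟩
    c * aₜ (x ∷ t) + d * aᶜₜ (x ∷ t) ∎)
  where open ≤-Reasoning

^a+^b≤^i+^j : ∀ k .{{_ : NonZero k}} {a b i j} → i ≤ a → a ≤ b → i + j ≡ a + b →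
              k ^ a + k ^ b ≤ k ^ i + k ^ j
^a+^b≤^i+^j k {a} {b} {i} {j} i≤a a≤b i+j≡a+b with m≤n⇒∃[o]m+o≡n i≤a
... | e , refl = begin
  k ^ (i + e) + k ^ b   ≡⟨ cong (λ s → s + k ^ b) (^-distribˡ-+-* k i e) ⟩
  k ^ i * k ^ e + k ^ b ≤⟨ rearrangement (^-monoʳ-≤ k (≤-trans (m≤m+n i e) a≤b)) (m^n>0 k e) ⟩
  k ^ i + k ^ e * k ^ b ≡⟨ cong (_+_ (k ^ i)) (sym (^-distribˡ-+-* k e b)) ⟩
  k ^ i + k ^ (e + b)   ≡⟨ cong (λ s → k ^ i + k ^ s) (sym j≡e+b) ⟩
  k ^ i + k ^ j         ∎
  where
  open ≤-Reasoning
  j≡e+b : j ≡ e + b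
  j≡e+b = +-cancelˡ-≡ i j (e + b) (trans i+j≡a+b (+-assoc i e b))

m≤n⇒m≤⌊[m+n]/2⌋ : ∀ {m n} → m ≤ n → m ≤ ⌊ m + n /2⌋
m≤n⇒m≤⌊[m+n]/2⌋ {m} {n} m≤n = subst (_≤ ⌊ m + n /2⌋) (sym (n≡⌊n+n/2⌋ m)) (⌊n/2⌋-mono (+-monoʳ-≤ m m≤n))

^⌊n/2⌋+^⌈n/2⌉≤^i+^j : ∀ k .{{_ : NonZero k}} {i j n} → i + j ≡ n →
                      k ^ ⌊ n /2⌋ + k ^ ⌈ n /2⌉ ≤ k ^ i + k ^ j
^⌊n/2⌋+^⌈n/2⌉≤^i+^j k {i} {j} {n} i+j≡n =
  [ ordered i+j≡n
  , (λ j≤i → subst (k ^ ⌊ n /2⌋ + k ^ ⌈ n /2⌉ ≤_) (+-comm (k ^ j) (k ^ i))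
                     (ordered (trans (+-comm j i) i+j≡n) j≤i))
  ]′ (≤-total i j)
  where
  ordered : ∀ {i j} → i + j ≡ n → i ≤ j → k ^ ⌊ n /2⌋ + k ^ ⌈ n /2⌉ ≤ k ^ i + k ^ j
  ordered {i} {j} refl i≤j =
    ^a+^b≤^i+^j k {j = j} (m≤n⇒m≤⌊[m+n]/2⌋ i≤j) (⌊n/2⌋≤⌈n/2⌉ (i + j)) (sym (⌊n/2⌋+⌈n/2⌉≡n (i + j)))

k^⌊n/2⌋+k^⌈n/2⌉≤aₜ+aᶜₜ : ∀ {k n} .{{_ : NonZero k}} (t : TString k n) →
                         k ^ ⌊ n /2⌋ + k ^ ⌈ n /2⌉ ≤ aₜ t + aᶜₜ t
k^⌊n/2⌋+k^⌈n/2⌉≤aₜ+aᶜₜ {k} t =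
  let i , j , i+j≡n , ≤P+Q = weighted-sum-≥-extremal 1 1 t in
  ≤-trans (^⌊n/2⌋+^⌈n/2⌉≤^i+^j k {i} {j} i+j≡n)
          (subst₂ _≤_ (cong₂ _+_ (*-identityˡ (k ^ i)) (*-identityˡ (k ^ j)))
                      (cong₂ _+_ (*-identityˡ (aₜ t)) (*-identityˡ (aᶜₜ t))) ≤P+Q)

theorem7p4 : (k n : ℕ) → k ≥ 2 → n ≥ 1 →
  -- shortest length over nontrivial t is k^(n-1)
  ((t : TString k n) → ¬ AllOnes t → ¬ AllKs t → + (k ^ (n ∸ 1)) ≤ℤ Lₜ t)
  -- achieved by n-1 ones and one 2
  × ((t : TString k n) → countLetter 1 t ≡ n ∸ 1 → countLetter 2 t ≡ 1 → Lₜ t ≡ + (k ^ (n ∸ 1)))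
  -- achieved by n-1 copies of k and one k-1
  × ((t : TString k n) → countLetter k t ≡ n ∸ 1 → countLetter (k ∸ 1) t ≡ 1 → Lₜ t ≡ + (k ^ (n ∸ 1)))
  -- longest length
  × ((t : TString k n) → Lₜ t ≤ℤ ((+ (k ^ n) +ℤ + 2) - + (k ^ ⌊ n /2⌋)) - + (k ^ ⌈ n /2⌉))
  -- achieved by ⌊n/2⌋ ones and ⌈n/2⌉ k's, or vice versa
  × ((t : TString k n) →
      ((countLetter 1 t ≡ ⌊ n /2⌋ × countLetter k t ≡ ⌈ n /2⌉)
        ⊎ (countLetter 1 t ≡ ⌈ n /2⌉ × countLetter k t ≡ ⌊ n /2⌋)) →
      Lₜ t ≡ ((+ (k ^ n) +ℤ + 2) - + (k ^ ⌊ n /2⌋)) - + (k ^ ⌈ n /2⌉))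
theorem7p4 k@(suc _) n@(suc m) k≥2 _ =
    (λ t ¬ones ¬ks → subst (+ (k ^ m) ≤ℤ_) (sym (Lₜ≡⊖ t))
      (m+n≤o⇒+n≤o⊖m (aₜ+aᶜₜ+k^m≤k^[1+m]+2 m t (¬AllOnes⇒2≤aₜ t ¬ones) (¬AllKs⇒2≤aᶜₜ t ¬ks))))
  , (λ t c₁ c₂ → trans (Lₜ≡⊖ t) (m+n≡o⇒o⊖m≡+n (aₜ+aᶜₜ-ones-and-a-two t c₁ c₂)))
  , (λ t cₖ cₖ₋₁ → trans (Lₜ≡⊖ t) (m+n≡o⇒o⊖m≡+n (aₜ+aᶜₜ-ks-and-a-predecessor t cₖ cₖ₋₁)))
  , (λ t → subst₂ _≤ℤ_ (sym (Lₜ≡⊖ t)) (sym longest≡⊖)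
      (⊖-monoʳ-≥-≤ (k ^ n + 2) (k^⌊n/2⌋+k^⌈n/2⌉≤aₜ+aᶜₜ t)))
  , λ where
      t (inj₁ (c₁ , cₖ)) → balanced⇒Lₜ≡longest t (aₜ+aᶜₜ-ones-and-ks k≥2 t c₁ cₖ (⌊n/2⌋+⌈n/2⌉≡n n))
      t (inj₂ (c₁ , cₖ)) → balanced⇒Lₜ≡longest t (trans (aₜ+aᶜₜ-ones-and-ks k≥2 t c₁ cₖ ⌈n/2⌉+⌊n/2⌋≡n)
                                               (+-comm (k ^ ⌈ n /2⌉) (k ^ ⌊ n /2⌋)))
  where
  longest≡⊖ : ((+ (k ^ n) +ℤ + 2) - + (k ^ ⌊ n /2⌋)) - + (k ^ ⌈ n /2⌉)
              ≡ (k ^ n + 2) ⊖ (k ^ ⌊ n /2⌋ + k ^ ⌈ n /2⌉)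
  longest≡⊖ = [+m+2-+a]-+b≡[m+2]⊖[a+b] (k ^ n) (k ^ ⌊ n /2⌋) (k ^ ⌈ n /2⌉)
  ⌈n/2⌉+⌊n/2⌋≡n : ⌈ n /2⌉ + ⌊ n /2⌋ ≡ n
  ⌈n/2⌉+⌊n/2⌋≡n = trans (+-comm ⌈ n /2⌉ ⌊ n /2⌋) (⌊n/2⌋+⌈n/2⌉≡n n)
  balanced⇒Lₜ≡longest : (t : TString k n) → aₜ t + aᶜₜ t ≡ k ^ ⌊ n /2⌋ + k ^ ⌈ n /2⌉ →
               Lₜ t ≡ ((+ (k ^ n) +ℤ + 2) - + (k ^ ⌊ n /2⌋)) - + (k ^ ⌈ n /2⌉)
  balanced⇒Lₜ≡longest t S≡ = trans (Lₜ≡⊖ t) (trans (cong ((k ^ n + 2) ⊖_) S≡) (sym longest≡⊖))
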